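{- Let $q$ be a prime power, $n,r$ positive integers, and let $\{U_1,\ldots,U_r\}$ be a multi-Sidon space of $\mathbb{F}_{q^n}$. Then for any $i,j\in\{1,\ldots,r\}$, if $a,c\in U_i\setminus\{0\}$ and $b,d\in U_j\setminus\{0\}$ satisfy $ab=cd$, then $\{a\mathbb{F}_q,b\mathbb{F}_q\}=\{c\mathbb{F}_q,d\mathbb{F}_q\}$.
   Context: $e\mathbb{F}_q=\{e\lambda:\lambda\in\mathbb{F}_q\}$. $\mathrm{Orb}(U)=\{\alpha U:\alpha\in\mathbb{F}_{q^n}^*\}$. A set $\{U_1,\ldots,U_r\}$ of $\mathbb{F}_q$-subspaces of $\mathbb{F}_{q^n}$ is a multi-Sidon space if: $\mathrm{Orb}(U_i)\cap\mathrm{Orb}(U_j)=\emptyset$ for $i\neq j$; $\dim_{\mathbb{F}_q}(U_i)\geq 2$ and $|\mathrm{Orb}(U_i)|=\frac{q^n-1}{q-1}$ for all $i$; and $\dim_{\mathbb{F}_q}(U_i\cap\alpha U_j)\leq 1$ for every $\alpha\in\mathbb{F}_{q^n}$ and all $i,j$ with $U_i\neq\alpha U_j$. -}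

module Defs where

open import Level using (Level; _⊔_; suc)
open import Algebra.Bundles using (CommutativeRing)
open import Data.Nat as ℕ using (ℕ; zero; _∸_; _^_)
import Data.Nat.DivMod as DM
open import Data.Nat.Primality using (Prime)
open import Data.Fin using (Fin)
open import Data.Product using (Σ; ∃; ∃-syntax; _×_; _,_)
open import Data.Sum using (_⊎_)
open import Relation.Nullary using (¬_)
open import Relation.Unary using (Pred)
open import Relation.Binary.PropositionalEquality using (_≡_)

IsPrimePower : ℕ → Set
IsPrimePower q = Σ ℕ λ p → Σ ℕ λ k → Prime p × (1 ℕ.≤ k) × (q ≡ p ^ k)

-- (q^n - 1)/(q - 1), for q ≥ 2 (the value for q < 2 is irrelevant)
orbSize : ℕ → ℕ → ℕ
orbSize zero n = 0
orbSize (ℕ.suc zero) n = 0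
orbSize (ℕ.suc (ℕ.suc k)) n = (ℕ.suc (ℕ.suc k) ^ n ∸ 1) DM./ ℕ.suc k

record Field (c ℓ : Level) : Set (suc (c ⊔ ℓ)) where
  field
    commRing : CommutativeRing c ℓ
  open CommutativeRing commRing public
  field
    1≉0     : ¬ (1# ≈ 0#)
    inverse : ∀ x → ¬ (x ≈ 0#) → ∃[ y ] (x * y ≈ 1#)

module FieldTheory {c ℓ : Level} (F : Field c ℓ) where
  open Field F

  HasCard : Pred Carrier ℓ → ℕ → Set (c ⊔ ℓ)
  HasCard A N = Σ (Fin N → Carrier) λ e →
      (∀ i → A (e i))
    × (∀ i j → e i ≈ e j → i ≡ j)
    × (∀ x → A x → ∃[ i ] (x ≈ e i))

  FieldHasCard : ℕ → Set (c ⊔ ℓ)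
  FieldHasCard N = Σ (Fin N → Carrier) λ e →
      (∀ i j → e i ≈ e j → i ≡ j)
    × (∀ x → ∃[ i ] (x ≈ e i))

  record IsSubfield (K : Pred Carrier ℓ) : Set (c ⊔ ℓ) where
    field
      resp  : ∀ {x y} → x ≈ y → K x → K y
      has0  : K 0#
      has1  : K 1#
      +-cl  : ∀ {x y} → K x → K y → K (x + y)
      neg-cl : ∀ {x} → K x → K (- x)
      *-cl  : ∀ {x y} → K x → K y → K (x * y)
      inv-cl : ∀ {x y} → K x → x * y ≈ 1# → K y

  module OverSubfield (K : Pred Carrier ℓ) where

    record IsSubspace (U : Pred Carrier ℓ) : Set (c ⊔ ℓ) where
      field
        resp  : ∀ {x y} → x ≈ y → U x → U y
        has0  : U 0#
        +-cl  : ∀ {x y} → U x → U y → U (x + y)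
        smul-cl : ∀ {λ' x} → K λ' → U x → U (λ' * x)

    _≐_ : ∀ {a b} → Pred Carrier a → Pred Carrier b → Set (c ⊔ a ⊔ b)
    A ≐ B = (∀ x → A x → B x) × (∀ x → B x → A x)

    _·_ : Carrier → Pred Carrier ℓ → Pred Carrier (c ⊔ ℓ)
    (α · U) x = ∃[ u ] (U u × x ≈ α * u)

    line : Carrier → Pred Carrier (c ⊔ ℓ)
    line e x = ∃[ λ' ] (K λ' × x ≈ e * λ')

    _∩_ : ∀ {a b} → Pred Carrier a → Pred Carrier b → Pred Carrier (a ⊔ b)
    (A ∩ B) x = A x × B x

    DimAtLeast2 : ∀ {a} → Pred Carrier a → Set (c ⊔ ℓ ⊔ a)
    DimAtLeast2 W = ∃[ u ] ∃[ v ] (W u × W v ×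
      (∀ λ' μ → K λ' → K μ → λ' * u + μ * v ≈ 0# → (λ' ≈ 0#) × (μ ≈ 0#)))

    DimAtMost1 : ∀ {a} → Pred Carrier a → Set (c ⊔ ℓ ⊔ a)
    DimAtMost1 W = ¬ DimAtLeast2 W

    -- |Orb(U)| = N, where Orb(U) = { α U : α ∈ F* }: an enumeration of N
    -- nonzero α's whose translates α U are pairwise distinct and exhaust Orb(U)
    OrbHasCard : Pred Carrier ℓ → ℕ → Set (c ⊔ ℓ)
    OrbHasCard U N = Σ (Fin N → Carrier) λ α →
        (∀ i → ¬ (α i ≈ 0#))
      × (∀ i j → (α i · U) ≐ (α j · U) → i ≡ j)
      × (∀ β → ¬ (β ≈ 0#) → ∃[ i ] ((β · U) ≐ (α i · U)))

    -- {U_1,...,U_r} is a multi-Sidon space of F (with K = F_q, |K| = q, |F| = q^n)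
    record IsMultiSidon (q n r : ℕ) (U : Fin r → Pred Carrier ℓ) : Set (c ⊔ ℓ) where
      field
        subspace : ∀ i → IsSubspace (U i)
        orbits-disjoint : ∀ i j → ¬ (i ≡ j) → ∀ α β → ¬ (α ≈ 0#) → ¬ (β ≈ 0#) →
                          ¬ ((α · U i) ≐ (β · U j))
        dim≥2 : ∀ i → DimAtLeast2 (U i)
        orbit-size : ∀ i → OrbHasCard (U i) (orbSize q n)
        sidon : ∀ i j α → ¬ (U i ≐ (α · U j) ) → DimAtMost1 (U i ∩ (α · U j))

-- Write ab = cd as a = γd, c = γb with γ = a/d. If c ∈ a𝔽_q then b ∈ d𝔽_q, and if γ ∈ 𝔽_q
-- then a ∈ d𝔽_q and c ∈ b𝔽_q. Otherwise a and c are 𝔽_q-independent elements of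
-- U_i ∩ γU_j, so the Sidon property forces U_i = γU_j. For i ≠ j this contradicts the
-- disjointness of orbits; for i = j it makes γ ∉ 𝔽_q a stabiliser of U_i, so the
-- stabiliser contains 𝔽_q* ∪ γ𝔽_q*, and counting Orb(U_i) × Stab(U_i) inside 𝔽_{q^n}*
-- gives 2(q^n - 1) ≤ q^n - 1, which is absurd.
module Submission where

open import Defs
open import Level using (Level)
open import Data.Nat using (ℕ; _≤_)
open import Data.Fin using (Fin)
open import Data.Product using (_×_)
open import Data.Sum using (_⊎_)
open import Relation.Nullary using (¬_)
open import Relation.Unary using (Pred)

import Data.Nat as ℕ
open import Data.Nat using (z≤n; s≤s)
open import Data.Nat.Properties using (<⇒≱)
open import Data.Fin as Fin using (zero; suc; punchIn; remQuot; combine)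
open import Data.Fin.Properties
  using (any?; punchIn-injective; punchInᵢ≢i; combine-remQuot; injective⇒≤)
open import Data.Product using (∃-syntax; _,_; proj₁; proj₂; uncurry)
open import Data.Sum using (inj₁; inj₂)
open import Data.Empty using (⊥-elim)
open import Function using (_∘_)
open import Relation.Nullary using (Dec; yes; no)
open import Relation.Nullary.Decidable using (decidable-stable)
open import Relation.Binary.PropositionalEquality as ≡ using (_≡_)

module OrbitSizeArithmetic where
  open import Data.Nat
  open import Data.Nat.Properties
  open import Data.Nat.DivMod using (_/_; m*n/n≡m)
  open import Data.Nat.Tactic.RingSolver using (solve-∀)
  open import Data.Nat.Primality using (¬prime[0]; ¬prime[1])
  open import Relation.Binary.PropositionalEquality
  open import Data.Empty using (⊥-elim)

  geometricSum : ℕ → ℕ → ℕ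
  geometricSum x zero    = 0
  geometricSum x (suc n) = x ^ n + geometricSum x n

  geometricSum-closedForm : ∀ k n → suc (k * geometricSum (suc k) n) ≡ suc k ^ n
  geometricSum-closedForm k zero    = cong suc (*-zeroʳ k)
  geometricSum-closedForm k (suc n) = begin
    suc (k * (suc k ^ n + G))
      ≡⟨ cong (λ t → suc (k * (t + G))) (sym (geometricSum-closedForm k n)) ⟩
    suc (k * (suc (k * G) + G))  ≡⟨ expand k G ⟩
    suc k * suc (k * G)          ≡⟨ cong (suc k *_) (geometricSum-closedForm k n) ⟩
    suc k ^ suc n                ∎
    where
      open ≡-Reasoning
      G : ℕ
      G = geometricSum (suc k) n
      expand : ∀ k G → suc (k * (suc (k * G) + G)) ≡ suc k * suc (k * G)
      expand = solve-∀

  orbSize-closedForm : ∀ k n → suc (orbSize (2 + k) n * suc k) ≡ (2 + k) ^ n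
  orbSize-closedForm k n = begin
    suc (orbSize (2 + k) n * suc k)  ≡⟨ cong (λ N → suc (N * suc k)) orbSize≡G ⟩
    suc (G * suc k)                  ≡⟨ cong suc (*-comm G (suc k)) ⟩
    suc (suc k * G)                  ≡⟨ geometricSum-closedForm (suc k) n ⟩
    (2 + k) ^ n                      ∎
    where
      open ≡-Reasoning
      G : ℕ
      G = geometricSum (2 + k) n
      orbSize≡G : orbSize (2 + k) n ≡ G
      orbSize≡G = begin
        ((2 + k) ^ n ∸ 1) / suc k
          ≡⟨ cong (λ t → (t ∸ 1) / suc k) (sym (geometricSum-closedForm (suc k) n)) ⟩
        (suc k * G) / suc k        ≡⟨ cong (_/ suc k) (*-comm (suc k) G) ⟩
        (G * suc k) / suc k        ≡⟨ m*n/n≡m G (suc k) ⟩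
        G                          ∎

  power<twice-orbSize : ∀ k n → 1 ≤ n → (2 + k) ^ n < suc (orbSize (2 + k) n * (suc k * 2))
  power<twice-orbSize k n 1≤n = begin-strict
    (2 + k) ^ n                ≡⟨ sym (orbSize-closedForm k n) ⟩
    suc S                      <⟨ s≤s (m<m+n S 0<S) ⟩
    suc (S + S)                ≡⟨ cong suc (double N k) ⟩
    suc (N * (suc k * 2))      ∎
    where
      open ≤-Reasoning
      N S : ℕ
      N = orbSize (2 + k) n
      S = N * suc k
      double : ∀ N k → N * suc k + N * suc k ≡ N * (suc k * 2)
      double = solve-∀
      0<S : 0 < S
      0<S = s≤s⁻¹ (begin
        2            ≤⟨ m≤m+n 2 k ⟩
        2 + k        ≡⟨ sym (*-identityʳ (2 + k)) ⟩
        (2 + k) ^ 1  ≤⟨ ^-monoʳ-≤ (2 + k) 1≤n ⟩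
        (2 + k) ^ n  ≡⟨ sym (orbSize-closedForm k n) ⟩
        suc S        ∎)

  primePower≥2 : ∀ {q} → IsPrimePower q → 2 ≤ q
  primePower≥2 (zero , _ , p-prime , _ , _) = ⊥-elim (¬prime[0] p-prime)
  primePower≥2 (suc zero , _ , p-prime , _ , _) = ⊥-elim (¬prime[1] p-prime)
  primePower≥2 (suc (suc p) , suc k , _ , _ , refl) =
    ≤-trans (m≤m+n 2 (p * 1)) (*-monoʳ-≤ (2 + p) (m^n>0 (2 + p) k))

open OrbitSizeArithmetic using (power<twice-orbSize; primePower≥2)

remQuot-injective : ∀ {m} n {i j : Fin (m ℕ.* n)} → remQuot {m} n i ≡ remQuot n j → i ≡ j
remQuot-injective {m} n {i} {j} eq = ≡.trans (≡.sym (combine-remQuot {m} n i))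
  (≡.trans (≡.cong (uncurry combine) eq) (combine-remQuot {m} n j))

module FieldProperties {c ℓ : Level} (F : Field c ℓ) where
  open Field F
  open FieldTheory F
  open import Relation.Binary.Reasoning.Setoid setoid

  inverse-cancel : ∀ {x w} y → x * w ≈ 1# → y ≈ w * (x * y)
  inverse-cancel {x} {w} y xw≈1 = begin
    y            ≈⟨ sym (*-identityˡ y) ⟩
    1# * y       ≈⟨ *-congʳ (trans (sym xw≈1) (*-comm x w)) ⟩
    (w * x) * y  ≈⟨ *-assoc w x y ⟩
    w * (x * y)  ∎

  *-cancelˡ-≉0 : ∀ {x y z} → ¬ x ≈ 0# → x * y ≈ x * z → y ≈ z
  *-cancelˡ-≉0 {x} {y} {z} x≉0 xy≈xz with w , xw≈1 ← inverse x x≉0 = begin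
    y            ≈⟨ inverse-cancel y xw≈1 ⟩
    w * (x * y)  ≈⟨ *-congˡ xy≈xz ⟩
    w * (x * z)  ≈⟨ inverse-cancel z xw≈1 ⟨
    z            ∎

  *-cancelʳ-≉0 : ∀ {x y z} → ¬ x ≈ 0# → y * x ≈ z * x → y ≈ z
  *-cancelʳ-≉0 {x} {y} {z} x≉0 yx≈zx =
    *-cancelˡ-≉0 x≉0 (trans (*-comm x y) (trans yx≈zx (*-comm z x)))

  x*y≈0⇒x≈0 : ∀ {x y} → ¬ y ≈ 0# → x * y ≈ 0# → x ≈ 0#
  x*y≈0⇒x≈0 {x} {y} y≉0 xy≈0 = *-cancelʳ-≉0 y≉0 (trans xy≈0 (sym (zeroˡ y)))

  *-≉0 : ∀ {x y} → ¬ x ≈ 0# → ¬ y ≈ 0# → ¬ x * y ≈ 0#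
  *-≉0 x≉0 y≉0 xy≈0 = x≉0 (x*y≈0⇒x≈0 y≉0 xy≈0)

  common-ratio : ∀ {a b c d} → ¬ d ≈ 0# → a * b ≈ c * d → ∃[ γ ] (a ≈ γ * d × c ≈ γ * b)
  common-ratio {a} {b} {c} {d} d≉0 ab≈cd with w , dw≈1 ← inverse d d≉0 =
    a * w , (begin
      a            ≈⟨ inverse-cancel a dw≈1 ⟩
      w * (d * a)  ≈⟨ *-congˡ (*-comm d a) ⟩
      w * (a * d)  ≈⟨ *-assoc w a d ⟨
      (w * a) * d  ≈⟨ *-congʳ (*-comm w a) ⟩
      (a * w) * d  ∎) , (begin
      c            ≈⟨ inverse-cancel c dw≈1 ⟩
      w * (d * c)  ≈⟨ *-congˡ (trans (*-comm d c) (sym ab≈cd)) ⟩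
      w * (a * b)  ≈⟨ *-assoc w a b ⟨
      (w * a) * b  ≈⟨ *-congʳ (*-comm w a) ⟩
      (a * w) * b  ∎)

  module Enumerated {Q} (F-card : FieldHasCard Q) where

    index : Carrier → Fin Q
    index x = proj₁ (proj₂ (proj₂ F-card) x)

    index-injective : ∀ {x y} → index x ≡ index y → x ≈ y
    index-injective {x} {y} eq = trans (proj₂ (proj₂ (proj₂ F-card) x))
      (trans (reflexive (≡.cong (proj₁ F-card) eq)) (sym (proj₂ (proj₂ (proj₂ F-card) y))))

    infix 4 _≟_
    _≟_ : ∀ x y → Dec (x ≈ y)
    x ≟ y with index x Fin.≟ index y
    ... | yes eq = yes (index-injective eq)
    ... | no neq = no λ x≈y → neq (proj₁ (proj₂ F-card) _ _
      (trans (sym (proj₂ (proj₂ (proj₂ F-card) x)))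
        (trans x≈y (proj₂ (proj₂ (proj₂ F-card) y)))))

    -- 0# is the extra element that makes the bound strict.
    nonzero-injection-bound : ∀ {M} (e : Fin M → Carrier) → (∀ i → ¬ e i ≈ 0#) →
                              (∀ i j → e i ≈ e j → i ≡ j) → M ℕ.< Q
    nonzero-injection-bound {M} e e≉0 e-injective = injective⇒≤ h-injective
      where
        h : Fin (ℕ.suc M) → Fin Q
        h zero    = index 0#
        h (suc i) = index (e i)
        h-injective : ∀ {i j} → h i ≡ h j → i ≡ j
        h-injective {zero}  {zero}  _  = ≡.refl
        h-injective {zero}  {suc j} eq = ⊥-elim (e≉0 j (sym (index-injective eq)))
        h-injective {suc i} {zero}  eq = ⊥-elim (e≉0 i (index-injective eq))
        h-injective {suc i} {suc j} eq = ≡.cong suc (e-injective i j (index-injective eq))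

module SubfieldProperties {c ℓ : Level} (F : Field c ℓ) {K : Pred (Field.Carrier F) ℓ}
                          (K-sub : FieldTheory.IsSubfield F K) where
  open Field F hiding (zero)
  open FieldTheory F
  open OverSubfield K
  open IsSubfield K-sub
  open IsMultiSidon
  open FieldProperties F
  open import Relation.Binary.Reasoning.Setoid setoid
  open import Algebra.Properties.Ring ring using (-‿distribˡ-*)
  open import Algebra.Properties.Group +-group using (inverseʳ-unique)

  ≐-sym : ∀ {a b} {X : Pred Carrier a} {Y : Pred Carrier b} → X ≐ Y → Y ≐ X
  ≐-sym (X⊆Y , Y⊆X) = Y⊆X , X⊆Y

  ≐-trans : ∀ {a b d} {X : Pred Carrier a} {Y : Pred Carrier b} {Z : Pred Carrier d} →
            X ≐ Y → Y ≐ Z → X ≐ Z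
  ≐-trans (X⊆Y , Y⊆X) (Y⊆Z , Z⊆Y) = (λ x → Y⊆Z x ∘ X⊆Y x) , (λ x → Y⊆X x ∘ Z⊆Y x)

  ·-cong : ∀ (U : Pred Carrier ℓ) {x y} → x ≈ y → (x · U) ≐ (y · U)
  ·-cong U x≈y = (λ z (u , Uu , z≈xu) → u , Uu , trans z≈xu (*-congʳ x≈y))
               , (λ z (u , Uu , z≈yu) → u , Uu , trans z≈yu (*-congʳ (sym x≈y)))

  ·-stabiliser : ∀ {U : Pred Carrier ℓ} {x} → (x · U) ≐ U → ∀ α → ((α * x) · U) ≐ (α · U)
  ·-stabiliser {U} {x} (xU⊆U , U⊆xU) α =
      (λ z (u , Uu , z≈αxu) → x * u , xU⊆U (x * u) (u , Uu , refl) , trans z≈αxu (*-assoc α x u))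
    , (λ z (u , Uu , z≈αu) → let (u′ , Uu′ , u≈xu′) = U⊆xU u Uu in
         u′ , Uu′ , trans z≈αu (trans (*-congˡ u≈xu′) (sym (*-assoc α x u′))))

  1·U≐U : ∀ {U} → IsSubspace U → (1# · U) ≐ U
  1·U≐U U-sub = (λ z (u , Uu , z≈1u) → IsSubspace.resp U-sub (sym (trans z≈1u (*-identityˡ u))) Uu)
              , (λ z Uz → z , Uz , sym (*-identityˡ z))

  subfield-stabilises : ∀ {U κ} → IsSubspace U → K κ → ¬ κ ≈ 0# → (κ · U) ≐ U
  subfield-stabilises {U} {κ} U-sub Kκ κ≉0 =
      (λ x (u , Uu , x≈κu) → U.resp (sym x≈κu) (U.smul-cl Kκ Uu))
    , (λ x Ux → let (w , κw≈1) = inverse κ κ≉0 in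
         w * x , U.smul-cl (inv-cl Kκ κw≈1) Ux , inverse-cancel x (trans (*-comm w κ) κw≈1))
    where module U = IsSubspace U-sub

  factor∈K : ∀ {x y} → K x → ¬ x ≈ 0# → K (x * y) → K y
  factor∈K {x} {y} Kx x≉0 Kxy with w , xw≈1 ← inverse x x≉0 =
    resp (sym (inverse-cancel y xw≈1)) (*-cl (inv-cl Kx xw≈1) Kxy)

  line-cancel : ∀ {x y μ} → K μ → ¬ μ ≈ 0# → line x (μ * y) → line x y
  line-cancel {x} {y} {μ} Kμ μ≉0 (l , Kl , μy≈xl) with w , μw≈1 ← inverse μ μ≉0 =
    w * l , *-cl (inv-cl Kμ μw≈1) Kl , (begin
      y            ≈⟨ inverse-cancel y μw≈1 ⟩
      w * (μ * y)  ≈⟨ *-congˡ μy≈xl ⟩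
      w * (x * l)  ≈⟨ *-comm w (x * l) ⟩
      (x * l) * w  ≈⟨ *-assoc x l w ⟩
      x * (l * w)  ≈⟨ *-congˡ (*-comm l w) ⟩
      x * (w * l)  ∎)

  line-transfer : ∀ {a b c d} → ¬ a ≈ 0# → a * b ≈ c * d → line a c → line d b
  line-transfer {a} {b} {c} {d} a≉0 ab≈cd (κ , Kκ , c≈aκ) = κ , Kκ , *-cancelˡ-≉0 a≉0 (begin
    a * b        ≈⟨ ab≈cd ⟩
    c * d        ≈⟨ *-congʳ c≈aκ ⟩
    (a * κ) * d  ≈⟨ *-assoc a κ d ⟩
    a * (κ * d)  ≈⟨ *-congˡ (*-comm κ d) ⟩
    a * (d * κ)  ∎)

  ∈line⇒line≐ : ∀ {x y} → ¬ y ≈ 0# → line x y → line x ≐ line y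
  ∈line⇒line≐ {x} {y} y≉0 (κ , Kκ , y≈xκ) =
      (λ z (l , Kl , z≈xl) → line-cancel Kκ κ≉0 (l , Kl , (begin
         κ * z        ≈⟨ *-congˡ z≈xl ⟩
         κ * (x * l)  ≈⟨ *-assoc κ x l ⟨
         (κ * x) * l  ≈⟨ *-congʳ (trans (*-comm κ x) (sym y≈xκ)) ⟩
         y * l        ∎)))
    , (λ z (l , Kl , z≈yl) → κ * l , *-cl Kκ Kl ,
         trans z≈yl (trans (*-congʳ y≈xκ) (*-assoc x κ l)))
    where
      κ≉0 : ¬ κ ≈ 0#
      κ≉0 κ≈0 = y≉0 (trans y≈xκ (trans (*-congˡ κ≈0) (zeroʳ x)))

  module Finite {q} (K-card : HasCard K q) {Q} (F-card : FieldHasCard Q) where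
    open Enumerated F-card using (_≟_)

    K? : ∀ x → Dec (K x)
    K? x with any? (λ t → x ≟ proj₁ K-card t)
    ... | yes (t , x≈et) = yes (resp (sym x≈et) (proj₁ (proj₂ K-card) t))
    ... | no ∄t          = no λ Kx → ∄t (proj₂ (proj₂ (proj₂ K-card)) x Kx)

    line? : ∀ x y → Dec (line x y)
    line? x y with any? (λ t → y ≟ x * proj₁ K-card t)
    ... | yes (t , y≈xet) = yes (proj₁ K-card t , proj₁ (proj₂ K-card) t , y≈xet)
    ... | no ∄t           = no λ (κ , Kκ , y≈xκ) →
      let (t , κ≈et) = proj₂ (proj₂ (proj₂ K-card)) κ Kκ in
      ∄t (t , trans y≈xκ (*-congˡ κ≈et))

    ∉line⇒independent : ∀ {x y} → ¬ x ≈ 0# → ¬ line x y →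
      ∀ λ′ μ → K λ′ → K μ → λ′ * x + μ * y ≈ 0# → (λ′ ≈ 0#) × (μ ≈ 0#)
    ∉line⇒independent {x} {y} x≉0 y∉xK λ′ μ Kλ Kμ dependence with μ ≟ 0#
    ... | no μ≉0 = ⊥-elim (y∉xK (line-cancel Kμ μ≉0 (- λ′ , neg-cl Kλ , (begin
      μ * y       ≈⟨ inverseʳ-unique (λ′ * x) (μ * y) dependence ⟩
      - (λ′ * x)  ≈⟨ -‿distribˡ-* λ′ x ⟩
      - λ′ * x    ≈⟨ *-comm (- λ′) x ⟩
      x * - λ′    ∎))))
    ... | yes μ≈0 = x*y≈0⇒x≈0 x≉0 (begin
      λ′ * x           ≈⟨ +-identityʳ (λ′ * x) ⟨
      λ′ * x + 0#      ≈⟨ +-congˡ (trans (*-congʳ μ≈0) (zeroˡ y)) ⟨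
      λ′ * x + μ * y   ≈⟨ dependence ⟩
      0#               ∎) , μ≈0

  module NonzeroEnumeration {k} (K-card : HasCard K (ℕ.suc k)) where
    private
      e : Fin (ℕ.suc k) → Carrier
      e = proj₁ K-card
      e∈K : ∀ i → K (e i)
      e∈K = proj₁ (proj₂ K-card)
      e-injective : ∀ i j → e i ≈ e j → i ≡ j
      e-injective = proj₁ (proj₂ (proj₂ K-card))
      index0 : ∃[ i ] (0# ≈ e i)
      index0 = proj₂ (proj₂ (proj₂ K-card)) 0# has0

    -- K* enumerated by skipping the index of 0#.
    nonzero : Fin k → Carrier
    nonzero s = e (punchIn (proj₁ index0) s)

    nonzero∈K : ∀ s → K (nonzero s)
    nonzero∈K s = e∈K _

    nonzero≉0 : ∀ s → ¬ nonzero s ≈ 0#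
    nonzero≉0 s s≈0 = punchInᵢ≢i (proj₁ index0) s (e-injective _ _ (trans s≈0 (proj₂ index0)))

    nonzero-injective : ∀ s t → nonzero s ≈ nonzero t → s ≡ t
    nonzero-injective s t eq = punchIn-injective (proj₁ index0) s t (e-injective _ _ eq)

  orbit-stabiliser-bound : ∀ {Q N m U} → FieldHasCard Q → OrbHasCard U N →
    (g : Fin m → Carrier) → (∀ s → ¬ g s ≈ 0#) → (∀ s t → g s ≈ g t → s ≡ t) →
    (∀ s → (g s · U) ≐ U) → N ℕ.* m ℕ.< Q
  orbit-stabiliser-bound {N = N} {m} {U} F-card (α , α≉0 , α-injective , _)
                         g g≉0 g-injective g-stab =
    Enumerated.nonzero-injection-bound F-card (uncurry Φ ∘ remQuot m)
      (λ x → *-≉0 (α≉0 _) (g≉0 _))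
      (λ x y eq → remQuot-injective m (Φ-injective eq))
    where
      Φ : Fin N → Fin m → Carrier
      Φ i s = α i * g s
      Φ-injective : ∀ {i s j t} → Φ i s ≈ Φ j t → (i , s) ≡ (j , t)
      Φ-injective {i} {s} {j} {t} eq
        with ≡.refl ← α-injective i j (≐-trans (≐-sym (·-stabiliser (g-stab s) (α i)))
                                      (≐-trans (·-cong U eq) (·-stabiliser (g-stab t) (α j))))
        = ≡.cong (i ,_) (g-injective s t (*-cancelˡ-≉0 (α≉0 i) eq))

  stabiliser⊆K : ∀ {q n U γ} → 2 ≤ q → 1 ≤ n → HasCard K q → FieldHasCard (q ℕ.^ n) →
    IsSubspace U → OrbHasCard U (orbSize q n) → ¬ γ ≈ 0# → (γ · U) ≐ U → K γ
  stabiliser⊆K {n = n} {U} {γ} (s≤s (s≤s (z≤n {k}))) 1≤n K-card F-card U-sub U-orb γ≉0 γU≐U =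
    decidable-stable (Finite.K? K-card F-card γ) λ γ∉K →
      <⇒≱ (power<twice-orbSize k n 1≤n)
        (orbit-stabiliser-bound F-card U-orb (coset ∘ remQuot 2) (coset≉0 ∘ remQuot 2)
          (λ x y eq → remQuot-injective 2 (coset-injective γ∉K (remQuot 2 x) (remQuot 2 y) eq))
          (coset-stabilises ∘ remQuot 2))
    where
      open NonzeroEnumeration K-card

      coset : Fin (ℕ.suc k) × Fin 2 → Carrier
      coset (s , zero)     = nonzero s
      coset (s , suc zero) = nonzero s * γ

      coset≉0 : ∀ x → ¬ coset x ≈ 0#
      coset≉0 (s , zero)     = nonzero≉0 s
      coset≉0 (s , suc zero) = *-≉0 (nonzero≉0 s) γ≉0

      coset-stabilises : ∀ x → (coset x · U) ≐ U
      coset-stabilises (s , zero)     = subfield-stabilises U-sub (nonzero∈K s) (nonzero≉0 s)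
      coset-stabilises (s , suc zero) =
        ≐-trans (·-stabiliser γU≐U (nonzero s)) (subfield-stabilises U-sub (nonzero∈K s) (nonzero≉0 s))

      mixed⇒γ∈K : ∀ s t → nonzero s ≈ nonzero t * γ → K γ
      mixed⇒γ∈K s t eq = factor∈K (nonzero∈K t) (nonzero≉0 t) (resp eq (nonzero∈K s))

      coset-injective : ¬ K γ → ∀ x y → coset x ≈ coset y → x ≡ y
      coset-injective _ (s , zero) (t , zero) eq = ≡.cong (_, zero) (nonzero-injective s t eq)
      coset-injective _ (s , suc zero) (t , suc zero) eq =
        ≡.cong (_, suc zero) (nonzero-injective s t (*-cancelʳ-≉0 γ≉0 eq))
      coset-injective γ∉K (s , zero) (t , suc zero) eq = ⊥-elim (γ∉K (mixed⇒γ∈K s t eq))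
      coset-injective γ∉K (s , suc zero) (t , zero) eq = ⊥-elim (γ∉K (mixed⇒γ∈K t s (sym eq)))

  translate≐⇒∈K : ∀ {q n r U} → IsPrimePower q → 1 ≤ n → HasCard K q → FieldHasCard (q ℕ.^ n) →
    IsMultiSidon q n r U → ∀ i j {γ} → ¬ γ ≈ 0# → U i ≐ (γ · U j) → K γ
  translate≐⇒∈K q-pp 1≤n K-card F-card multiSidon i j {γ} γ≉0 Ui≐γUj with i Fin.≟ j
  ... | no i≢j = ⊥-elim (orbits-disjoint multiSidon i j i≢j 1# γ 1≉0 γ≉0
                          (≐-trans (1·U≐U (subspace multiSidon i)) Ui≐γUj))
  ... | yes ≡.refl = stabiliser⊆K (primePower≥2 q-pp) 1≤n K-card F-card
                        (subspace multiSidon i) (orbit-size multiSidon i) γ≉0 (≐-sym Ui≐γUj)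

proposition3p5 : ∀ {c ℓ : Level} (F : Field c ℓ) (K : Pred (Field.Carrier F) ℓ)
    (q n r : ℕ) → IsPrimePower q → 1 ≤ n → 1 ≤ r →
    FieldTheory.IsSubfield F K → FieldTheory.HasCard F K q →
    FieldTheory.FieldHasCard F (q Data.Nat.^ n) →
    (U : Fin r → Pred (Field.Carrier F) ℓ) →
    FieldTheory.OverSubfield.IsMultiSidon F K q n r U →
    ∀ i j a b c' d →
    U i a → ¬ (Field._≈_ F a (Field.0# F)) →
    U i c' → ¬ (Field._≈_ F c' (Field.0# F)) →
    U j b → ¬ (Field._≈_ F b (Field.0# F)) →
    U j d → ¬ (Field._≈_ F d (Field.0# F)) →
    Field._≈_ F (Field._*_ F a b) (Field._*_ F c' d) →
    (FieldTheory.OverSubfield._≐_ F K (FieldTheory.OverSubfield.line F K a) (FieldTheory.OverSubfield.line F K c')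
      × FieldTheory.OverSubfield._≐_ F K (FieldTheory.OverSubfield.line F K b) (FieldTheory.OverSubfield.line F K d))
    ⊎ (FieldTheory.OverSubfield._≐_ F K (FieldTheory.OverSubfield.line F K a) (FieldTheory.OverSubfield.line F K d)
      × FieldTheory.OverSubfield._≐_ F K (FieldTheory.OverSubfield.line F K b) (FieldTheory.OverSubfield.line F K c'))
proposition3p5 F K q n r q-pp 1≤n _ K-sub K-card F-card U multiSidon i j a b c d
               Ua a≉0 Uc c≉0 Ub b≉0 Ud d≉0 ab≈cd = cases (line? a c) (K? γ)
  where
    open Field F
    open FieldTheory F
    open OverSubfield K
    open IsMultiSidon multiSidon using (sidon)
    open FieldProperties F
    open SubfieldProperties F K-sub
    open Finite K-card F-card

    ratio : ∃[ γ ] (a ≈ γ * d × c ≈ γ * b)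
    ratio = common-ratio d≉0 ab≈cd

    γ : Carrier
    γ = proj₁ ratio

    a≈γd : a ≈ γ * d
    a≈γd = proj₁ (proj₂ ratio)

    c≈γb : c ≈ γ * b
    c≈γb = proj₂ (proj₂ ratio)

    γ≉0 : ¬ γ ≈ 0#
    γ≉0 γ≈0 = a≉0 (trans a≈γd (trans (*-congʳ γ≈0) (zeroˡ d)))

    cases : Dec (line a c) → Dec (K γ) →
      ((line a ≐ line c) × (line b ≐ line d)) ⊎ ((line a ≐ line d) × (line b ≐ line c))
    cases (yes c∈aK) _ =
      inj₁ (∈line⇒line≐ c≉0 c∈aK , ≐-sym (∈line⇒line≐ b≉0 (line-transfer a≉0 ab≈cd c∈aK)))
    cases (no _) (yes Kγ) =
      inj₂ ( ≐-sym (∈line⇒line≐ a≉0 (γ , Kγ , trans a≈γd (*-comm γ d)))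
           , ∈line⇒line≐ c≉0 (γ , Kγ , trans c≈γb (*-comm γ b)))
    cases (no c∉aK) (no γ∉K) = ⊥-elim (sidon i j γ
      (γ∉K ∘ translate≐⇒∈K q-pp 1≤n K-card F-card multiSidon i j γ≉0)
      (a , c , (Ua , d , Ud , a≈γd) , (Uc , b , Ub , c≈γb) , ∉line⇒independent a≉0 c∉aK))
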